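{- Let $k_1\preceq k_2\preceq\cdots\preceq k_s$ be positive integers, let $r=\lfloor\log_2(k_s)\rfloor+1$, and $$c_0(k_1,\dots,k_s)=\frac{1}{2^r}\sum_{m=0}^{2^r-1}(-1)^{\binom{m}{k_1}+\cdots+\binom{m}{k_s}}.$$ Then $$c_0(k_1,\dots,k_s)=1-\Delta(s)\,2^{1-w_2(k_s)}-\sum_{j=1}^{\lfloor s/2\rfloor}\left(2^{w_2(k_{2j}-k_{2j-1})}-1\right)2^{1-w_2(k_{2j})},$$ where $\Delta(s)=s\bmod 2$.
   Context: For positive integers $a,b$, $a\preceq b$ means that every power of two appearing in the binary expansion of $a$ also appears in the binary expansion of $b$ (e.g. $10\preceq14$). $w_2(k)$ is the sum of the binary digits of $k$. -}

module Defs where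

open import Data.Nat using (ℕ; zero; suc; _+_; _*_; _∸_; _^_; _/_; _%_; _≤_; _<_)
open import Data.Nat.Properties using (m^n≢0)
open import Data.Nat.Combinatorics using (_C_)
open import Data.Nat.Logarithm using (⌊log₂_⌋)
open import Data.Integer as ℤ using (ℤ; +_; -1ℤ)
open import Data.Rational as ℚ using (ℚ)
open import Relation.Binary.PropositionalEquality using (_≡_)

bit : ℕ → ℕ → ℕ
bit a i = (a / 2 ^ i) {{m^n≢0 2 i}} % 2

_⪯_ : ℕ → ℕ → Set
a ⪯ b = ∀ i → bit a i ≡ 1 → bit b i ≡ 1

sumℕ : ℕ → (ℕ → ℕ) → ℕ
sumℕ zero    f = 0
sumℕ (suc n) f = sumℕ n f + f n

sumℤ : ℕ → (ℕ → ℤ) → ℤ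
sumℤ zero    f = + 0
sumℤ (suc n) f = sumℤ n f ℤ.+ f n

sumℚ : ℕ → (ℕ → ℚ) → ℚ
sumℚ zero    f = ℚ.0ℚ
sumℚ (suc n) f = sumℚ n f ℚ.+ f n

-- binary digit sum w₂(k) (bits at positions ≥ k+1 are zero since k < 2^(k+1))
w₂ : ℕ → ℕ
w₂ k = sumℕ (suc k) (bit k)

pow2frac : ℕ → ℕ → ℚ
pow2frac e w = ((+ (2 ^ e)) ℚ./ (2 ^ w)) {{m^n≢0 2 w}}

-- c₀(k₁,…,k_s) for the family k 1, …, k s
c₀ : ℕ → (ℕ → ℕ) → ℚ
c₀ s k = ((sumℤ (2 ^ r) λ m → -1ℤ ℤ.^ sumℕ s (λ i → m C k (suc i))) ℚ./ (2 ^ r)) {{m^n≢0 2 r}}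
  where r = ⌊log₂ (k s) ⌋ + 1

rhs : ℕ → (ℕ → ℕ) → ℚ
rhs s k = ℚ.1ℚ ℚ.- (+ (s % 2) ℚ./ 1) ℚ.* pow2frac 1 (w₂ (k s))
          ℚ.- sumℚ (s / 2) (λ j' → let j = suc j' in
                ((+ (2 ^ w₂ (k (2 * j) ∸ k (2 * j ∸ 1)))) ℚ./ 1 ℚ.- ℚ.1ℚ)
                ℚ.* pow2frac 1 (w₂ (k (2 * j))))

{-# OPTIONS --safe #-}
-- By Lucas' theorem, m C k is odd exactly when k ⪯ m. Along a chain k₁ ⪯ ⋯ ⪯ k_s the indices i for
-- which m C kᵢ is odd therefore form an initial segment, so the sign (-1)^(Σᵢ m C kᵢ) equals
-- 1 - 2 Σₜ (-1)^t [m C k_{t+1} odd]. Among the m < 2^r exactly 2^(r - w₂(k)) have k ⪯ m, hence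
-- c₀ = 1 - Σₜ (-1)^t 2^(1 - w₂(k_{t+1})). Grouping the terms in consecutive pairs and using
-- w₂(b) = w₂(a) + w₂(b - a) for a ⪯ b gives the formula; for odd s the last term stays unpaired.

module Submission where

open import Defs
open import Data.Nat using (ℕ; suc; _<_; _≤_)
open import Relation.Binary.PropositionalEquality using (_≡_)

open import Algebra.Bundles using (Semiring)
import Algebra.Properties.CommutativeSemigroup as CommSemigroupProperties
open import Data.Empty using (⊥-elim)
open import Data.Nat.Base using (zero; z≤n; s≤s; NonZero; parity)
import Data.Nat.Base as ℕ
open import Data.Nat.Combinatorics using (_C_; nCk+nC[k+1]≡[n+1]C[k+1]; k>n⇒nCk≡0)
open import Data.Nat.DivMod using (m*n/n≡m; m/n≡1+[m∸n]/n; m*n%n≡0; [m+kn]%n≡m%n; n/1≡n; m/n/o≡m/[n*o]; 0/n≡0; m<n⇒m/n≡0)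
import Data.Nat.Properties as ℕP
open import Data.Parity.Base as ℙ using (Parity; 0ℙ; 1ℙ)
import Data.Parity.Properties as ℙ
open import Data.Sum using (_⊎_; inj₁; inj₂)
open import Function using (_∘_)
open import Function.Bundles using (_⇔_; mk⇔; Equivalence)
import Function.Properties.Equivalence as ⇔
open import Relation.Binary.Core using (Rel)
open import Relation.Binary.Definitions using (Reflexive; Transitive)
open import Relation.Binary.PropositionalEquality using (refl; sym; trans; cong; cong₂; subst; subst₂; module ≡-Reasoning)
import Relation.Binary.Reasoning.Setoid as SetoidReasoning
open import Relation.Nullary using (¬_; yes; no)

double : ℕ → ℕ
double zero    = zero
double (suc n) = suc (suc (double n))

module FiniteSums {c ℓ} (R : Semiring c ℓ) where

  open Semiring R renaming (refl to ≈-refl; sym to ≈-sym; trans to ≈-trans)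

  module Properties
    (∑ : ℕ → (ℕ → Carrier) → Carrier)
    (∑-zero : ∀ f → ∑ 0 f ≈ 0#)
    (∑-suc : ∀ n f → ∑ (suc n) f ≈ ∑ n f + f n)
    where

    open SetoidReasoning setoid
    open CommSemigroupProperties +-commutativeSemigroup using (interchange)

    ∑-cong : ∀ n {f g} → (∀ i → i < n → f i ≈ g i) → ∑ n f ≈ ∑ n g
    ∑-cong zero    {f} {g} _   = ≈-trans (∑-zero f) (≈-sym (∑-zero g))
    ∑-cong (suc n) {f} {g} f≈g = begin
      ∑ (suc n) f   ≈⟨ ∑-suc n f ⟩
      ∑ n f + f n   ≈⟨ +-cong (∑-cong n (λ i i<n → f≈g i (ℕP.m<n⇒m<1+n i<n))) (f≈g n ℕP.≤-refl) ⟩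
      ∑ n g + g n   ≈⟨ ∑-suc n g ⟨
      ∑ (suc n) g   ∎

    ∑-zeros : ∀ n → ∑ n (λ _ → 0#) ≈ 0#
    ∑-zeros zero    = ∑-zero _
    ∑-zeros (suc n) = begin
      ∑ (suc n) (λ _ → 0#)   ≈⟨ ∑-suc n _ ⟩
      ∑ n (λ _ → 0#) + 0#    ≈⟨ +-congʳ (∑-zeros n) ⟩
      0# + 0#                ≈⟨ +-identityˡ 0# ⟩
      0#                     ∎

    ∑-+ : ∀ n f g → ∑ n (λ i → f i + g i) ≈ ∑ n f + ∑ n g
    ∑-+ zero    f g = begin
      ∑ 0 _              ≈⟨ ∑-zero _ ⟩
      0#                 ≈⟨ +-identityˡ 0# ⟨
      0# + 0#            ≈⟨ +-cong (∑-zero f) (∑-zero g) ⟨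
      ∑ 0 f + ∑ 0 g      ∎
    ∑-+ (suc n) f g = begin
      ∑ (suc n) (λ i → f i + g i)         ≈⟨ ∑-suc n _ ⟩
      ∑ n (λ i → f i + g i) + (f n + g n) ≈⟨ +-congʳ (∑-+ n f g) ⟩
      (∑ n f + ∑ n g) + (f n + g n)       ≈⟨ interchange _ _ _ _ ⟩
      (∑ n f + f n) + (∑ n g + g n)       ≈⟨ +-cong (∑-suc n f) (∑-suc n g) ⟨
      ∑ (suc n) f + ∑ (suc n) g           ∎

    ∑-*ˡ : ∀ n x f → ∑ n (λ i → x * f i) ≈ x * ∑ n f
    ∑-*ˡ zero    x f = begin
      ∑ 0 _        ≈⟨ ∑-zero _ ⟩
      0#           ≈⟨ zeroʳ x ⟨
      x * 0#       ≈⟨ *-congˡ (∑-zero f) ⟨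
      x * ∑ 0 f    ∎
    ∑-*ˡ (suc n) x f = begin
      ∑ (suc n) (λ i → x * f i)      ≈⟨ ∑-suc n _ ⟩
      ∑ n (λ i → x * f i) + x * f n  ≈⟨ +-congʳ (∑-*ˡ n x f) ⟩
      x * ∑ n f + x * f n            ≈⟨ distribˡ x (∑ n f) (f n) ⟨
      x * (∑ n f + f n)              ≈⟨ *-congˡ (∑-suc n f) ⟨
      x * ∑ (suc n) f                ∎

    ∑-*ʳ : ∀ n x f → ∑ n (λ i → f i * x) ≈ ∑ n f * x
    ∑-*ʳ zero    x f = begin
      ∑ 0 _        ≈⟨ ∑-zero _ ⟩
      0#           ≈⟨ zeroˡ x ⟨
      0# * x       ≈⟨ *-congʳ (∑-zero f) ⟨
      ∑ 0 f * x    ∎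
    ∑-*ʳ (suc n) x f = begin
      ∑ (suc n) (λ i → f i * x)      ≈⟨ ∑-suc n _ ⟩
      ∑ n (λ i → f i * x) + f n * x  ≈⟨ +-congʳ (∑-*ʳ n x f) ⟩
      ∑ n f * x + f n * x            ≈⟨ distribʳ x (∑ n f) (f n) ⟨
      (∑ n f + f n) * x              ≈⟨ *-congʳ (∑-suc n f) ⟨
      ∑ (suc n) f * x                ∎

    ∑-swap : ∀ m n (F : ℕ → ℕ → Carrier) → ∑ m (λ i → ∑ n (F i)) ≈ ∑ n (λ j → ∑ m (λ i → F i j))
    ∑-swap zero    n F = begin
      ∑ 0 _                     ≈⟨ ∑-zero _ ⟩
      0#                        ≈⟨ ∑-zeros n ⟨
      ∑ n (λ _ → 0#)            ≈⟨ ∑-cong n (λ j _ → ∑-zero (λ i → F i j)) ⟨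
      ∑ n (λ j → ∑ 0 (λ i → F i j)) ∎
    ∑-swap (suc m) n F = begin
      ∑ (suc m) (λ i → ∑ n (F i))                        ≈⟨ ∑-suc m _ ⟩
      ∑ m (λ i → ∑ n (F i)) + ∑ n (F m)                  ≈⟨ +-congʳ (∑-swap m n F) ⟩
      ∑ n (λ j → ∑ m (λ i → F i j)) + ∑ n (F m)          ≈⟨ ∑-+ n _ _ ⟨
      ∑ n (λ j → ∑ m (λ i → F i j) + F m j)              ≈⟨ ∑-cong n (λ j _ → ∑-suc m (λ i → F i j)) ⟨
      ∑ n (λ j → ∑ (suc m) (λ i → F i j))                ∎

    ∑-double : ∀ n f → ∑ (double n) f ≈ ∑ n (λ j → f (double j) + f (suc (double j)))
    ∑-double zero    f = ≈-trans (∑-zero f) (≈-sym (∑-zero _))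
    ∑-double (suc n) f = begin
      ∑ (suc (suc (double n))) f                              ≈⟨ ∑-suc _ f ⟩
      ∑ (suc (double n)) f + f (suc (double n))               ≈⟨ +-congʳ (∑-suc _ f) ⟩
      ∑ (double n) f + f (double n) + f (suc (double n))      ≈⟨ +-assoc _ _ _ ⟩
      ∑ (double n) f + (f (double n) + f (suc (double n)))    ≈⟨ +-congʳ (∑-double n f) ⟩
      ∑ n _ + (f (double n) + f (suc (double n)))             ≈⟨ ∑-suc n _ ⟨
      ∑ (suc n) (λ j → f (double j) + f (suc (double j)))     ∎

    ∑-shift : ∀ n f → ∑ (suc n) f ≈ f 0 + ∑ n (f ∘ suc)
    ∑-shift zero    f = begin
      ∑ 1 f          ≈⟨ ∑-suc 0 f ⟩
      ∑ 0 f + f 0    ≈⟨ +-comm _ _ ⟩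
      f 0 + ∑ 0 f    ≈⟨ +-congˡ (≈-trans (∑-zero f) (≈-sym (∑-zero _))) ⟩
      f 0 + ∑ 0 (f ∘ suc) ∎
    ∑-shift (suc n) f = begin
      ∑ (suc (suc n)) f                  ≈⟨ ∑-suc (suc n) f ⟩
      ∑ (suc n) f + f (suc n)            ≈⟨ +-congʳ (∑-shift n f) ⟩
      f 0 + ∑ n (f ∘ suc) + f (suc n)    ≈⟨ +-assoc _ _ _ ⟩
      f 0 + (∑ n (f ∘ suc) + f (suc n))  ≈⟨ +-congˡ (∑-suc n (f ∘ suc)) ⟨
      f 0 + ∑ (suc n) (f ∘ suc)          ∎

consecutive⇒chain : ∀ {a ℓ} {A : Set a} (_∼_ : Rel A ℓ) → Reflexive _∼_ → Transitive _∼_ →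
        ∀ {n} (f : ℕ → A) → (∀ i → suc i < n → f i ∼ f (suc i)) → ∀ {t u} → t ≤ u → u < n → f t ∼ f u
consecutive⇒chain _∼_ refl′ trans′ f step {u = zero}  z≤n   _       = refl′
consecutive⇒chain _∼_ refl′ trans′ f step {u = suc u} t≤1+u 1+u<n with ℕP.m≤n⇒m<n∨m≡n t≤1+u
... | inj₂ refl      = refl′
... | inj₁ (s≤s t≤u) = trans′ (consecutive⇒chain _∼_ refl′ trans′ f step t≤u (ℕP.<-trans (ℕP.n<1+n u) 1+u<n)) (step u 1+u<n)

module BinaryExpansions where

  open import Data.Nat.Base using (_+_; _*_; _∸_; _^_; _/_; _%_)

  -- Recursion over this view follows the binary digits structurally, which halving on ℕ does not.
  data Binary : ℕ → Set where
    zero : Binary 0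
    even : ∀ {n} → Binary n → Binary (double n)
    odd  : ∀ {n} → Binary n → Binary (suc (double n))

  binary-suc : ∀ {n} → Binary n → Binary (suc n)
  binary-suc zero     = odd zero
  binary-suc (even b) = odd b
  binary-suc (odd b)  = even (binary-suc b)

  binary : ∀ n → Binary n
  binary zero    = zero
  binary (suc n) = binary-suc (binary n)

  data EvenOrOdd : ℕ → Set where
    even : ∀ q → EvenOrOdd (double q)
    odd  : ∀ q → EvenOrOdd (suc (double q))

  evenOrOdd : ∀ n → EvenOrOdd n
  evenOrOdd zero = even 0
  evenOrOdd (suc n) with evenOrOdd n
  ... | even q = odd q
  ... | odd q  = even (suc q)

  double≡*2 : ∀ q → double q ≡ q * 2
  double≡*2 zero    = refl
  double≡*2 (suc q) = cong (suc ∘ suc) (double≡*2 q)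

  2*≡double : ∀ n → 2 * n ≡ double n
  2*≡double n = trans (ℕP.*-comm 2 n) (sym (double≡*2 n))

  double-mono-< : ∀ {m n} → m < n → suc (double m) < double n
  double-mono-< {zero}  {suc n} _         = s≤s (s≤s z≤n)
  double-mono-< {suc m} {suc n} (s≤s m<n) = s≤s (s≤s (double-mono-< m<n))

  double-/2 : ∀ q → double q / 2 ≡ q
  double-/2 q = trans (cong (_/ 2) (double≡*2 q)) (m*n/n≡m q 2)

  1+double-/2 : ∀ q → suc (double q) / 2 ≡ q
  1+double-/2 zero    = refl
  1+double-/2 (suc q) = trans (m/n≡1+[m∸n]/n {suc (double (suc q))} {2} (s≤s (s≤s z≤n))) (cong suc (1+double-/2 q))

  double-%2 : ∀ q → double q % 2 ≡ 0
  double-%2 q = trans (cong (_% 2) (double≡*2 q)) (m*n%n≡0 q 2)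

  1+double-%2 : ∀ q → suc (double q) % 2 ≡ 1
  1+double-%2 q = trans (cong (λ n → suc n % 2) (double≡*2 q)) ([m+kn]%n≡m%n 1 q 2)

  parity-double : ∀ q → parity (double q) ≡ 0ℙ
  parity-double zero    = refl
  parity-double (suc q) = parity-double q

  parity-1+double : ∀ q → parity (suc (double q)) ≡ 1ℙ
  parity-1+double zero    = refl
  parity-1+double (suc q) = parity-1+double q

  parity-pascal : ∀ n k → parity (suc n C suc k) ≡ parity (n C k) ℙ.+ parity (n C suc k)
  parity-pascal n k = trans (cong parity (sym (nCk+nC[k+1]≡[n+1]C[k+1] n k))) (ℙ.+-homo-+ (n C k) (n C suc k))

  parity[2aC1+2c]≡0ℙ            : ∀ a c → parity (double a C suc (double c)) ≡ 0ℙ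
  parity[2aC2c]≡parity[aCc]     : ∀ a c → parity (double a C double c) ≡ parity (a C c)
  parity[1+2aC2c]≡parity[aCc]   : ∀ a c → parity (suc (double a) C double c) ≡ parity (a C c)
  parity[1+2aC1+2c]≡parity[aCc] : ∀ a c → parity (suc (double a) C suc (double c)) ≡ parity (a C c)

  parity[2aC1+2c]≡0ℙ zero    c = refl
  parity[2aC1+2c]≡0ℙ (suc a) c = begin
    parity (suc (suc (double a)) C suc (double c))   ≡⟨ parity-pascal (suc (double a)) (double c) ⟩
    parity (suc (double a) C double c) ℙ.+ parity (suc (double a) C suc (double c))
      ≡⟨ cong₂ ℙ._+_ (parity[1+2aC2c]≡parity[aCc] a c) (parity[1+2aC1+2c]≡parity[aCc] a c) ⟩
    parity (a C c) ℙ.+ parity (a C c)                 ≡⟨ ℙ.p+p≡0ℙ (parity (a C c)) ⟩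
    0ℙ                                                ∎
    where open ≡-Reasoning

  parity[2aC2c]≡parity[aCc] zero    zero    = refl
  parity[2aC2c]≡parity[aCc] zero    (suc c) = refl
  parity[2aC2c]≡parity[aCc] (suc a) zero    = refl
  parity[2aC2c]≡parity[aCc] (suc a) (suc c) = begin
    parity (suc (suc (double a)) C suc (suc (double c)))   ≡⟨ parity-pascal (suc (double a)) (suc (double c)) ⟩
    parity (suc (double a) C suc (double c)) ℙ.+ parity (suc (double a) C double (suc c))
      ≡⟨ cong₂ ℙ._+_ (parity[1+2aC1+2c]≡parity[aCc] a c) (parity[1+2aC2c]≡parity[aCc] a (suc c)) ⟩
    parity (a C c) ℙ.+ parity (a C suc c)                   ≡⟨ parity-pascal a c ⟨
    parity (suc a C suc c)                                  ∎
    where open ≡-Reasoning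

  parity[1+2aC2c]≡parity[aCc] zero    zero    = refl
  parity[1+2aC2c]≡parity[aCc] zero    (suc c) = refl
  parity[1+2aC2c]≡parity[aCc] (suc a) zero    = refl
  parity[1+2aC2c]≡parity[aCc] (suc a) (suc c) = begin
    parity (suc (double (suc a)) C suc (suc (double c)))   ≡⟨ parity-pascal (double (suc a)) (suc (double c)) ⟩
    parity (double (suc a) C suc (double c)) ℙ.+ parity (double (suc a) C double (suc c))
      ≡⟨ cong₂ ℙ._+_ (parity[2aC1+2c]≡0ℙ (suc a) c) (parity[2aC2c]≡parity[aCc] (suc a) (suc c)) ⟩
    parity (suc a C suc c)                                  ∎
    where open ≡-Reasoning

  parity[1+2aC1+2c]≡parity[aCc] zero    zero    = refl
  parity[1+2aC1+2c]≡parity[aCc] zero    (suc c) = refl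
  parity[1+2aC1+2c]≡parity[aCc] (suc a) c = begin
    parity (suc (double (suc a)) C suc (double c))   ≡⟨ parity-pascal (double (suc a)) (double c) ⟩
    parity (double (suc a) C double c) ℙ.+ parity (double (suc a) C suc (double c))
      ≡⟨ cong₂ ℙ._+_ (parity[2aC2c]≡parity[aCc] (suc a) c) (parity[2aC1+2c]≡0ℙ (suc a) c) ⟩
    parity (suc a C c) ℙ.+ 0ℙ                         ≡⟨ ℙ.+-identityʳ (parity (suc a C c)) ⟩
    parity (suc a C c)                                ∎
    where open ≡-Reasoning

  bit₀ : ∀ n → bit n 0 ≡ n % 2
  bit₀ n = cong (_% 2) (n/1≡n n)

  bit-suc : ∀ n i → bit n (suc i) ≡ bit (n / 2) i
  bit-suc n i = cong (_% 2) (sym (m/n/o≡m/[n*o] n 2 (2 ^ i) {{_}} {{ℕP.m^n≢0 2 i}} {{ℕP.m^n≢0 2 (suc i)}}))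

  bit-zero : ∀ i → bit 0 i ≡ 0
  bit-zero i = cong (_% 2) (0/n≡0 (2 ^ i) {{ℕP.m^n≢0 2 i}})

  bit-double-suc : ∀ q i → bit (double q) (suc i) ≡ bit q i
  bit-double-suc q i = trans (bit-suc (double q) i) (cong (λ n → bit n i) (double-/2 q))

  bit-1+double-suc : ∀ q i → bit (suc (double q)) (suc i) ≡ bit q i
  bit-1+double-suc q i = trans (bit-suc (suc (double q)) i) (cong (λ n → bit n i) (1+double-/2 q))

  0⪯ : ∀ m → 0 ⪯ m
  0⪯ m i bit≡1 with trans (sym (bit-zero i)) bit≡1
  ... | ()

  ⪯-refl : ∀ {a} → a ⪯ a
  ⪯-refl _ bit≡1 = bit≡1

  ⪯-trans : ∀ {a b c} → a ⪯ b → b ⪯ c → a ⪯ c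
  ⪯-trans a⪯b b⪯c i = b⪯c i ∘ a⪯b i

  ⪯⇔tail⪯ : ∀ {a b c q} → (bit a 0 ≡ 1 → bit b 0 ≡ 1) →
            (∀ i → bit a (suc i) ≡ bit c i) → (∀ i → bit b (suc i) ≡ bit q i) → a ⪯ b ⇔ c ⪯ q
  ⪯⇔tail⪯ low a↑ b↑ = mk⇔
    (λ a⪯b i e → trans (sym (b↑ i)) (a⪯b (suc i) (trans (a↑ i) e)))
    (λ { c⪯q zero e → low e ; c⪯q (suc i) e → trans (b↑ i) (c⪯q i (trans (sym (a↑ i)) e)) })

  2c⪯2q⇔c⪯q : ∀ {c q} → double c ⪯ double q ⇔ c ⪯ q
  2c⪯2q⇔c⪯q {c} {q} = ⪯⇔tail⪯ even-low (bit-double-suc c) (bit-double-suc q)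
    where
    even-low : bit (double c) 0 ≡ 1 → bit (double q) 0 ≡ 1
    even-low e with trans (sym (trans (bit₀ (double c)) (double-%2 c))) e
    ... | ()

  2c⪯1+2q⇔c⪯q : ∀ {c q} → double c ⪯ suc (double q) ⇔ c ⪯ q
  2c⪯1+2q⇔c⪯q {c} {q} = ⪯⇔tail⪯ (λ _ → trans (bit₀ (suc (double q))) (1+double-%2 q)) (bit-double-suc c) (bit-1+double-suc q)

  1+2c⪯1+2q⇔c⪯q : ∀ {c q} → suc (double c) ⪯ suc (double q) ⇔ c ⪯ q
  1+2c⪯1+2q⇔c⪯q {c} {q} = ⪯⇔tail⪯ (λ _ → trans (bit₀ (suc (double q))) (1+double-%2 q)) (bit-1+double-suc c) (bit-1+double-suc q)

  1+2c⋠2q : ∀ {c q} → ¬ (suc (double c) ⪯ double q)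
  1+2c⋠2q {c} {q} h with trans (sym (trans (bit₀ (double q)) (double-%2 q))) (h 0 (trans (bit₀ (suc (double c))) (1+double-%2 c)))
  ... | ()

  ≡1ℙ-⇔-transport : ∀ {p q} {A B : Set} → p ≡ q → (q ≡ 1ℙ ⇔ A) → (B ⇔ A) → (p ≡ 1ℙ ⇔ B)
  ≡1ℙ-⇔-transport refl q⇔A B⇔A = ⇔.trans q⇔A (⇔.sym B⇔A)

  lucas : ∀ {k} → Binary k → ∀ m → parity (m C k) ≡ 1ℙ ⇔ k ⪯ m
  lucas zero m = mk⇔ (λ _ → 0⪯ m) (λ _ → refl)
  lucas (even {c} k) m with evenOrOdd m
  ... | even q = ≡1ℙ-⇔-transport (parity[2aC2c]≡parity[aCc] q c) (lucas k q) 2c⪯2q⇔c⪯q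
  ... | odd q  = ≡1ℙ-⇔-transport (parity[1+2aC2c]≡parity[aCc] q c) (lucas k q) 2c⪯1+2q⇔c⪯q
  lucas (odd {c} k) m with evenOrOdd m
  ... | odd q  = ≡1ℙ-⇔-transport (parity[1+2aC1+2c]≡parity[aCc] q c) (lucas k q) 1+2c⪯1+2q⇔c⪯q
  ... | even q = mk⇔ (λ odd → ⊥-elim (0ℙ≢1ℙ (trans (sym (parity[2aC1+2c]≡0ℙ q c)) odd))) (⊥-elim ∘ 1+2c⋠2q)
    where
    0ℙ≢1ℙ : ¬ (0ℙ ≡ 1ℙ)
    0ℙ≢1ℙ ()

  ⪯⇒≤ : ∀ {k m} → k ⪯ m → k ≤ m
  ⪯⇒≤ {k} {m} k⪯m with k ℕP.≤? m
  ... | yes k≤m = k≤m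
  ... | no k≰m with trans (cong parity (sym (k>n⇒nCk≡0 (ℕP.≰⇒> k≰m)))) (Equivalence.from (lucas (binary k) m) k⪯m)
  ...   | ()

  module ℕ-Sums = FiniteSums.Properties ℕP.+-*-semiring sumℕ (λ _ → refl) (λ _ _ → refl)

  1+double<2^suc : ∀ {q} N → q < 2 ^ N → suc (double q) < 2 ^ suc N
  1+double<2^suc {q} N q<2^N = begin-strict
    suc (double q)   <⟨ ℕP.n<1+n _ ⟩
    double (suc q)   ≡⟨ double≡*2 (suc q) ⟩
    suc q * 2        ≤⟨ ℕP.*-monoˡ-≤ 2 q<2^N ⟩
    2 ^ N * 2        ≡⟨ ℕP.*-comm (2 ^ N) 2 ⟩
    2 ^ suc N        ∎
    where open ℕP.≤-Reasoning

  n<2^n : ∀ n → n < 2 ^ n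
  n<2^n zero    = s≤s z≤n
  n<2^n (suc n) = ℕP.≤-<-trans (s≤s n≤double) (1+double<2^suc n (n<2^n n))
    where
    n≤double : n ≤ double n
    n≤double = subst (n ≤_) (sym (double≡*2 n)) (ℕP.m≤m*n n 2)

  lowBitCount : ℕ → ℕ → ℕ
  lowBitCount N n = sumℕ N (bit n)

  lowBitCount-suc : ∀ N n → lowBitCount (suc N) n ≡ n % 2 + lowBitCount N (n / 2)
  lowBitCount-suc N n =
    trans (ℕ-Sums.∑-shift N (bit n)) (cong₂ _+_ (bit₀ n) (ℕ-Sums.∑-cong N (λ i _ → bit-suc n i)))

  bit-≥ : ∀ {n} i → n < 2 ^ i → bit n i ≡ 0
  bit-≥ {n} i n<2^i = cong (_% 2) (m<n⇒m/n≡0 {{ℕP.m^n≢0 2 i}} n<2^i)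

  lowBitCount-stable : ∀ A {n} j → n < 2 ^ A → lowBitCount (A + j) n ≡ lowBitCount A n
  lowBitCount-stable A {n} zero    _      = cong (λ N → lowBitCount N n) (ℕP.+-identityʳ A)
  lowBitCount-stable A {n} (suc j) n<2^A = begin
    lowBitCount (A + suc j) n            ≡⟨ cong (λ N → lowBitCount N n) (ℕP.+-suc A j) ⟩
    lowBitCount (A + j) n + bit n (A + j) ≡⟨ cong₂ _+_ (lowBitCount-stable A j n<2^A) (bit-≥ (A + j) n<2^[A+j]) ⟩
    lowBitCount A n + 0                  ≡⟨ ℕP.+-identityʳ _ ⟩
    lowBitCount A n                      ∎
    where
    open ≡-Reasoning
    n<2^[A+j] : n < 2 ^ (A + j)
    n<2^[A+j] = ℕP.<-≤-trans n<2^A (ℕP.^-monoʳ-≤ 2 (ℕP.m≤m+n A j))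

  lowBitCount-irrelevant : ∀ A B {n} → n < 2 ^ A → n < 2 ^ B → lowBitCount A n ≡ lowBitCount B n
  lowBitCount-irrelevant A B {n} n<2^A n<2^B with ℕP.≤-total A B
  ... | inj₁ A≤B = trans (sym (lowBitCount-stable A (B ∸ A) n<2^A)) (cong (λ N → lowBitCount N n) (ℕP.m+[n∸m]≡n A≤B))
  ... | inj₂ B≤A = trans (cong (λ N → lowBitCount N n) (sym (ℕP.m+[n∸m]≡n B≤A))) (lowBitCount-stable B (A ∸ B) n<2^B)

  w₂≡lowBitCount : ∀ N {n} → n < 2 ^ N → w₂ n ≡ lowBitCount N n
  w₂≡lowBitCount N {n} = lowBitCount-irrelevant (suc n) N (ℕP.<-trans (n<2^n n) (ℕP.^-monoʳ-< 2 (s≤s (s≤s z≤n)) (ℕP.n<1+n n)))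

  w₂-double : ∀ q → w₂ (double q) ≡ w₂ q
  w₂-double q = begin
    w₂ (double q)                                 ≡⟨ w₂≡lowBitCount (suc q) (ℕP.<-trans (ℕP.n<1+n _) (1+double<2^suc q (n<2^n q))) ⟩
    lowBitCount (suc q) (double q)                ≡⟨ lowBitCount-suc q (double q) ⟩
    double q % 2 + lowBitCount q (double q / 2)   ≡⟨ cong₂ (λ r h → r + lowBitCount q h) (double-%2 q) (double-/2 q) ⟩
    lowBitCount q q                               ≡⟨ w₂≡lowBitCount q (n<2^n q) ⟨
    w₂ q                                          ∎
    where open ≡-Reasoning

  w₂-double-suc : ∀ q → w₂ (suc (double q)) ≡ suc (w₂ q)
  w₂-double-suc q = begin
    w₂ (suc (double q))                                       ≡⟨ w₂≡lowBitCount (suc q) (1+double<2^suc q (n<2^n q)) ⟩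
    lowBitCount (suc q) (suc (double q))                      ≡⟨ lowBitCount-suc q (suc (double q)) ⟩
    suc (double q) % 2 + lowBitCount q (suc (double q) / 2)   ≡⟨ cong₂ (λ r h → r + lowBitCount q h) (1+double-%2 q) (1+double-/2 q) ⟩
    suc (lowBitCount q q)                                     ≡⟨ cong suc (w₂≡lowBitCount q (n<2^n q)) ⟨
    suc (w₂ q)                                                ∎
    where open ≡-Reasoning

  double-∸ : ∀ f c → double f ∸ double c ≡ double (f ∸ c)
  double-∸ f       zero    = refl
  double-∸ zero    (suc c) = refl
  double-∸ (suc f) (suc c) = double-∸ f c

  1+double-∸ : ∀ {f c} → c ≤ f → suc (double f) ∸ double c ≡ suc (double (f ∸ c))
  1+double-∸ z≤n       = refl
  1+double-∸ (s≤s c≤f) = 1+double-∸ c≤f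

  w₂-⪯-∸ : ∀ {b} → Binary b → ∀ a → a ⪯ b → w₂ a + w₂ (b ∸ a) ≡ w₂ b
  w₂-⪯-∸ zero a a⪯0 with ⪯⇒≤ a⪯0
  ... | z≤n = refl
  w₂-⪯-∸ (even {f} b) a a⪯b with evenOrOdd a
  ... | odd c  = ⊥-elim (1+2c⋠2q a⪯b)
  ... | even c = begin
    w₂ (double c) + w₂ (double f ∸ double c)  ≡⟨ cong₂ _+_ (w₂-double c) (trans (cong w₂ (double-∸ f c)) (w₂-double (f ∸ c))) ⟩
    w₂ c + w₂ (f ∸ c)                         ≡⟨ w₂-⪯-∸ b c (Equivalence.to 2c⪯2q⇔c⪯q a⪯b) ⟩
    w₂ f                                      ≡⟨ w₂-double f ⟨
    w₂ (double f)                             ∎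
    where open ≡-Reasoning
  w₂-⪯-∸ (odd {f} b) a a⪯b with evenOrOdd a
  ... | even c = begin
    w₂ (double c) + w₂ (suc (double f) ∸ double c)  ≡⟨ cong₂ _+_ (w₂-double c) (cong w₂ (1+double-∸ (⪯⇒≤ c⪯f))) ⟩
    w₂ c + w₂ (suc (double (f ∸ c)))              ≡⟨ cong (w₂ c +_) (w₂-double-suc (f ∸ c)) ⟩
    w₂ c + suc (w₂ (f ∸ c))                       ≡⟨ ℕP.+-suc (w₂ c) _ ⟩
    suc (w₂ c + w₂ (f ∸ c))                       ≡⟨ cong suc (w₂-⪯-∸ b c c⪯f) ⟩
    suc (w₂ f)                                    ≡⟨ w₂-double-suc f ⟨
    w₂ (suc (double f))                           ∎
    where
    open ≡-Reasoning
    c⪯f : c ⪯ f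
    c⪯f = Equivalence.to 2c⪯1+2q⇔c⪯q a⪯b
  ... | odd c = begin
    w₂ (suc (double c)) + w₂ (double f ∸ double c)  ≡⟨ cong₂ _+_ (w₂-double-suc c) (trans (cong w₂ (double-∸ f c)) (w₂-double (f ∸ c))) ⟩
    suc (w₂ c + w₂ (f ∸ c))                       ≡⟨ cong suc (w₂-⪯-∸ b c (Equivalence.to 1+2c⪯1+2q⇔c⪯q a⪯b)) ⟩
    suc (w₂ f)                                    ≡⟨ w₂-double-suc f ⟨
    w₂ (suc (double f))                           ∎
    where open ≡-Reasoning

  toBit : Parity → ℕ
  toBit 0ℙ = 0
  toBit 1ℙ = 1

  oddBinomialCount : ℕ → ℕ → ℕ
  oddBinomialCount r k = sumℕ (2 ^ r) (λ m → toBit (parity (m C k)))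

  2^suc≡double : ∀ r → 2 ^ suc r ≡ double (2 ^ r)
  2^suc≡double r = trans (ℕP.*-comm 2 (2 ^ r)) (sym (double≡*2 (2 ^ r)))

  oddBinomialCount-double : ∀ r c → oddBinomialCount (suc r) (double c) ≡ oddBinomialCount r c + oddBinomialCount r c
  oddBinomialCount-double r c = begin
    sumℕ (2 ^ suc r) (λ m → toBit (parity (m C double c)))               ≡⟨ cong (λ N → sumℕ N _) (2^suc≡double r) ⟩
    sumℕ (double (2 ^ r)) (λ m → toBit (parity (m C double c)))          ≡⟨ ℕ-Sums.∑-double (2 ^ r) _ ⟩
    sumℕ (2 ^ r) (λ q → toBit (parity (double q C double c)) + toBit (parity (suc (double q) C double c)))
      ≡⟨ ℕ-Sums.∑-cong (2 ^ r) (λ q _ → cong₂ (λ x y → toBit x + toBit y) (parity[2aC2c]≡parity[aCc] q c) (parity[1+2aC2c]≡parity[aCc] q c)) ⟩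
    sumℕ (2 ^ r) (λ q → toBit (parity (q C c)) + toBit (parity (q C c))) ≡⟨ ℕ-Sums.∑-+ (2 ^ r) _ _ ⟩
    oddBinomialCount r c + oddBinomialCount r c                          ∎
    where open ≡-Reasoning

  oddBinomialCount-1+double : ∀ r c → oddBinomialCount (suc r) (suc (double c)) ≡ oddBinomialCount r c
  oddBinomialCount-1+double r c = begin
    sumℕ (2 ^ suc r) (λ m → toBit (parity (m C suc (double c))))          ≡⟨ cong (λ N → sumℕ N _) (2^suc≡double r) ⟩
    sumℕ (double (2 ^ r)) (λ m → toBit (parity (m C suc (double c))))     ≡⟨ ℕ-Sums.∑-double (2 ^ r) _ ⟩
    sumℕ (2 ^ r) (λ q → toBit (parity (double q C suc (double c))) + toBit (parity (suc (double q) C suc (double c))))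
      ≡⟨ ℕ-Sums.∑-cong (2 ^ r) (λ q _ → cong₂ (λ x y → toBit x + toBit y) (parity[2aC1+2c]≡0ℙ q c) (parity[1+2aC1+2c]≡parity[aCc] q c)) ⟩
    oddBinomialCount r c                                                  ∎
    where open ≡-Reasoning

  double-cancel-< : ∀ {c m} → double c < double m → c < m
  double-cancel-< {c} {m} 2c<2m = ℕP.*-cancelʳ-< 2 c m (subst₂ _<_ (double≡*2 c) (double≡*2 m) 2c<2m)

  oddBinomialCount*2^w₂≡2^r : ∀ r {k} → k < 2 ^ r → oddBinomialCount r k * 2 ^ w₂ k ≡ 2 ^ r
  oddBinomialCount*2^w₂≡2^r zero    (s≤s z≤n) = refl
  oddBinomialCount*2^w₂≡2^r (suc r) {k} k<2^[1+r] with evenOrOdd k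
  ... | even c = begin
    oddBinomialCount (suc r) (double c) * 2 ^ w₂ (double c)  ≡⟨ cong₂ _*_ (oddBinomialCount-double r c) (cong (2 ^_) (w₂-double c)) ⟩
    (N + N) * 2 ^ w₂ c                                       ≡⟨ ℕP.*-distribʳ-+ (2 ^ w₂ c) N N ⟩
    N * 2 ^ w₂ c + N * 2 ^ w₂ c                              ≡⟨ cong₂ _+_ IH IH ⟩
    2 ^ r + 2 ^ r                                            ≡⟨ cong (2 ^ r +_) (ℕP.+-identityʳ (2 ^ r)) ⟨
    2 ^ suc r                                                ∎
    where
    open ≡-Reasoning
    N : ℕ
    N = oddBinomialCount r c
    IH : N * 2 ^ w₂ c ≡ 2 ^ r
    IH = oddBinomialCount*2^w₂≡2^r r (double-cancel-< (subst (double c <_) (2^suc≡double r) k<2^[1+r]))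
  ... | odd c = begin
    oddBinomialCount (suc r) (suc (double c)) * 2 ^ w₂ (suc (double c))  ≡⟨ cong₂ _*_ (oddBinomialCount-1+double r c) (cong (2 ^_) (w₂-double-suc c)) ⟩
    N * (2 * 2 ^ w₂ c)                                                   ≡⟨ ℕP.*-assoc N 2 _ ⟨
    N * 2 * 2 ^ w₂ c                                                     ≡⟨ cong (_* 2 ^ w₂ c) (ℕP.*-comm N 2) ⟩
    2 * N * 2 ^ w₂ c                                                     ≡⟨ ℕP.*-assoc 2 N _ ⟩
    2 * (N * 2 ^ w₂ c)                                                   ≡⟨ cong (2 *_) IH ⟩
    2 ^ suc r                                                            ∎
    where
    open ≡-Reasoning
    N : ℕ
    N = oddBinomialCount r c
    IH : N * 2 ^ w₂ c ≡ 2 ^ r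
    IH = oddBinomialCount*2^w₂≡2^r r (double-cancel-< (ℕP.<-trans (ℕP.n<1+n _) (subst (suc (double c) <_) (2^suc≡double r) k<2^[1+r])))

module Signs where

  open import Data.Integer.Base using (ℤ; +_; -1ℤ; 1ℤ; _+_; _-_; -_; _*_; _^_)
  import Data.Integer.Properties as ℤP
  open import Data.Integer.Solver using (module +-*-Solver)
  open +-*-Solver using (solve; _:+_; _:-_; _:*_; _:=_; con)
  open BinaryExpansions using (toBit)

  module ℤ-Sums = FiniteSums.Properties ℤP.+-*-semiring sumℤ (λ _ → refl) (λ _ _ → refl)

  parity-cases : ∀ n → parity n ≡ 0ℙ ⊎ parity n ≡ 1ℙ
  parity-cases n with parity n
  ... | 0ℙ = inj₁ refl
  ... | 1ℙ = inj₂ refl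

  -1^[2+n] : ∀ n → -1ℤ ^ suc (suc n) ≡ -1ℤ ^ n
  -1^[2+n] n = trans (sym (ℤP.*-assoc -1ℤ -1ℤ (-1ℤ ^ n))) (ℤP.*-identityˡ (-1ℤ ^ n))

  -1^even : ∀ n → parity n ≡ 0ℙ → -1ℤ ^ n ≡ 1ℤ
  -1^odd  : ∀ n → parity n ≡ 1ℙ → -1ℤ ^ n ≡ -1ℤ
  -1^even zero          _    = refl
  -1^even (suc zero)    ()
  -1^even (suc (suc n)) even = trans (-1^[2+n] n) (-1^even n even)
  -1^odd  zero          ()
  -1^odd  (suc zero)    _    = refl
  -1^odd  (suc (suc n)) odd  = trans (-1^[2+n] n) (-1^odd n odd)

  1-2∑-1^t≡-1^n : ∀ n → 1ℤ - + 2 * sumℤ n (λ t → -1ℤ ^ t) ≡ -1ℤ ^ n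
  1-2∑-1^t≡-1^n zero    = refl
  1-2∑-1^t≡-1^n (suc n) = begin
    1ℤ - + 2 * (Σ + -1ℤ ^ n)              ≡⟨ solve 2 (λ x p → con 1ℤ :- con (+ 2) :* (x :+ p) := (con 1ℤ :- con (+ 2) :* x) :- con (+ 2) :* p) refl Σ (-1ℤ ^ n) ⟩
    (1ℤ - + 2 * Σ) - + 2 * -1ℤ ^ n        ≡⟨ cong (λ x → x - + 2 * -1ℤ ^ n) (1-2∑-1^t≡-1^n n) ⟩
    -1ℤ ^ n - + 2 * -1ℤ ^ n               ≡⟨ solve 1 (λ p → p :- con (+ 2) :* p := con -1ℤ :* p) refl (-1ℤ ^ n) ⟩
    -1ℤ ^ suc n                           ∎
    where
    open ≡-Reasoning
    Σ : ℤ
    Σ = sumℤ n (λ t → -1ℤ ^ t)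

  OddIndicesDownClosed : ℕ → (ℕ → ℕ) → Set
  OddIndicesDownClosed n a = ∀ {t u} → t ≤ u → u < n → parity (a u) ≡ 1ℙ → parity (a t) ≡ 1ℙ

  -1^∑≡1-2∑ : ∀ n (a : ℕ → ℕ) → OddIndicesDownClosed n a →
              -1ℤ ^ sumℕ n a ≡ 1ℤ - + 2 * sumℤ n (λ t → -1ℤ ^ t * + toBit (parity (a t)))
  -1^∑≡1-2∑ zero    a _      = refl
  -1^∑≡1-2∑ (suc n) a closed with parity-cases (a n)
  ... | inj₁ even = begin
    -1ℤ ^ (sumℕ n a ℕ.+ a n)          ≡⟨ ℤP.^-distribˡ-+-* -1ℤ (sumℕ n a) (a n) ⟩
    -1ℤ ^ sumℕ n a * -1ℤ ^ a n         ≡⟨ cong (-1ℤ ^ sumℕ n a *_) (-1^even (a n) even) ⟩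
    -1ℤ ^ sumℕ n a * 1ℤ                ≡⟨ ℤP.*-identityʳ _ ⟩
    -1ℤ ^ sumℕ n a                     ≡⟨ -1^∑≡1-2∑ n a (λ t≤u u<n → closed t≤u (ℕP.m<n⇒m<1+n u<n)) ⟩
    1ℤ - + 2 * X                       ≡⟨ cong (λ x → 1ℤ - + 2 * x) (ℤP.+-identityʳ X) ⟨
    1ℤ - + 2 * (X + + 0)               ≡⟨ cong (λ x → 1ℤ - + 2 * (X + x)) (ℤP.*-zeroʳ (-1ℤ ^ n)) ⟨
    1ℤ - + 2 * (X + -1ℤ ^ n * + 0)     ≡⟨ cong (λ p → 1ℤ - + 2 * (X + -1ℤ ^ n * + toBit p)) even ⟨
    1ℤ - + 2 * sumℤ (suc n) term       ∎
    where
    open ≡-Reasoning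
    term : ℕ → ℤ
    term t = -1ℤ ^ t * + toBit (parity (a t))
    X : ℤ
    X = sumℤ n term
  ... | inj₂ odd = begin
    -1ℤ ^ (sumℕ n a ℕ.+ a n)           ≡⟨ ℤP.^-distribˡ-+-* -1ℤ (sumℕ n a) (a n) ⟩
    -1ℤ ^ sumℕ n a * -1ℤ ^ a n          ≡⟨ cong₂ _*_ prefix-sign (-1^odd (a n) odd) ⟩
    -1ℤ ^ n * -1ℤ                       ≡⟨ ℤP.*-comm (-1ℤ ^ n) -1ℤ ⟩
    -1ℤ ^ suc n                         ≡⟨ 1-2∑-1^t≡-1^n (suc n) ⟨
    1ℤ - + 2 * sumℤ (suc n) (λ t → -1ℤ ^ t) ≡⟨ cong (λ x → 1ℤ - + 2 * x) (ℤ-Sums.∑-cong (suc n) term≡-1^t) ⟩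
    1ℤ - + 2 * sumℤ (suc n) term        ∎
    where
    open ≡-Reasoning
    term : ℕ → ℤ
    term t = -1ℤ ^ t * + toBit (parity (a t))
    term≡-1^t : ∀ t → t < suc n → -1ℤ ^ t ≡ term t
    term≡-1^t t (s≤s t≤n) = sym (trans (cong (λ p → -1ℤ ^ t * + toBit p) (closed t≤n ℕP.≤-refl odd)) (ℤP.*-identityʳ (-1ℤ ^ t)))
    prefix-sign : -1ℤ ^ sumℕ n a ≡ -1ℤ ^ n
    prefix-sign = begin
      -1ℤ ^ sumℕ n a                   ≡⟨ -1^∑≡1-2∑ n a (λ t≤u u<n → closed t≤u (ℕP.m<n⇒m<1+n u<n)) ⟩
      1ℤ - + 2 * sumℤ n term           ≡⟨ cong (λ x → 1ℤ - + 2 * x) (ℤ-Sums.∑-cong n (λ t t<n → term≡-1^t t (ℕP.m<n⇒m<1+n t<n))) ⟨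
      1ℤ - + 2 * sumℤ n (λ t → -1ℤ ^ t) ≡⟨ 1-2∑-1^t≡-1^n n ⟩
      -1ℤ ^ n                          ∎

  +-sumℕ : ∀ n f → + sumℕ n f ≡ sumℤ n (λ i → + f i)
  +-sumℕ zero    f = refl
  +-sumℕ (suc n) f = trans (ℤP.pos-+ (sumℕ n f) (f n)) (cong (_+ + f n) (+-sumℕ n f))

  sumℤ-ones : ∀ n → sumℤ n (λ _ → 1ℤ) ≡ + n
  sumℤ-ones zero    = refl
  sumℤ-ones (suc n) = trans (cong (_+ 1ℤ) (sumℤ-ones n)) (cong +_ (ℕP.+-comm n 1))

  ∑-1^∑≡D-2∑ : ∀ D n (a : ℕ → ℕ → ℕ) → (∀ m → OddIndicesDownClosed n (a m)) →
    sumℤ D (λ m → -1ℤ ^ sumℕ n (a m)) ≡ + D - + 2 * sumℤ n (λ t → -1ℤ ^ t * + sumℕ D (λ m → toBit (parity (a m t))))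
  ∑-1^∑≡D-2∑ D n a closed = begin
    sumℤ D (λ m → -1ℤ ^ sumℕ n (a m))         ≡⟨ ℤ-Sums.∑-cong D (λ m _ → -1^∑≡1-2∑ n (a m) (closed m)) ⟩
    sumℤ D (λ m → 1ℤ - + 2 * Y m)             ≡⟨ ℤ-Sums.∑-cong D (λ m _ → 1-2y≡1+[-2]y (Y m)) ⟩
    sumℤ D (λ m → 1ℤ + - + 2 * Y m)           ≡⟨ ℤ-Sums.∑-+ D _ _ ⟩
    sumℤ D (λ _ → 1ℤ) + sumℤ D (λ m → - + 2 * Y m) ≡⟨ cong₂ _+_ (sumℤ-ones D) (ℤ-Sums.∑-*ˡ D (- + 2) Y) ⟩
    + D + - + 2 * sumℤ D Y                    ≡⟨ cong (λ x → + D + - + 2 * x) ∑Y≡Z ⟩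
    + D + - + 2 * Z                           ≡⟨ 1-2y≡1+[-2]y′ ⟨
    + D - + 2 * Z                             ∎
    where
    open ≡-Reasoning
    b : ℕ → ℕ → ℕ
    b m t = toBit (parity (a m t))
    Y : ℕ → ℤ
    Y m = sumℤ n (λ t → -1ℤ ^ t * + b m t)
    Z : ℤ
    Z = sumℤ n (λ t → -1ℤ ^ t * + sumℕ D (λ m → b m t))
    1-2y≡1+[-2]y : ∀ y → 1ℤ - + 2 * y ≡ 1ℤ + - + 2 * y
    1-2y≡1+[-2]y y = solve 1 (λ y → con 1ℤ :- con (+ 2) :* y := con 1ℤ :+ con (- + 2) :* y) refl y
    1-2y≡1+[-2]y′ : + D - + 2 * Z ≡ + D + - + 2 * Z
    1-2y≡1+[-2]y′ = solve 2 (λ d z → d :- con (+ 2) :* z := d :+ con (- + 2) :* z) refl (+ D) Z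
    ∑Y≡Z : sumℤ D Y ≡ Z
    ∑Y≡Z = begin
      sumℤ D Y                                                ≡⟨ ℤ-Sums.∑-swap D n (λ m t → -1ℤ ^ t * + b m t) ⟩
      sumℤ n (λ t → sumℤ D (λ m → -1ℤ ^ t * + b m t))         ≡⟨ ℤ-Sums.∑-cong n (λ t _ → ℤ-Sums.∑-*ˡ D (-1ℤ ^ t) (λ m → + b m t)) ⟩
      sumℤ n (λ t → -1ℤ ^ t * sumℤ D (λ m → + b m t))         ≡⟨ ℤ-Sums.∑-cong n (λ t _ → cong (-1ℤ ^ t *_) (+-sumℕ D (λ m → b m t))) ⟨
      Z                                                       ∎

module Fractions where

  open import Data.Integer.Base as ℤ using (ℤ; +_)
  import Data.Integer.Properties as ℤP
  open import Data.Rational.Base using (ℚ; _/_; _+_; _-_; -_; _*_; 1ℚ; toℚᵘ)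
  import Data.Rational.Properties as ℚP
  open ℚP using (toℚᵘ-injective; toℚᵘ-homo-+; toℚᵘ-homo-*; toℚᵘ-homo‿-; toℚᵘ-fromℚᵘ)
  open import Data.Rational.Unnormalised.Base as ℚᵘ using (mkℚᵘ; *≡*)
  import Data.Rational.Unnormalised.Properties as ℚᵘP

  fromℤ : ℤ → ℚ
  fromℤ z = z / 1

  recip : (n : ℕ) → .{{NonZero n}} → ℚ
  recip n = + 1 / n

  toℚᵘ-/ : ∀ z d → toℚᵘ (z / suc d) ℚᵘ.≃ mkℚᵘ z d
  toℚᵘ-/ z d = toℚᵘ-fromℚᵘ (mkℚᵘ z d)

  fromℤ-homo-+ : ∀ a b → fromℤ (a ℤ.+ b) ≡ fromℤ a + fromℤ b
  fromℤ-homo-+ a b = toℚᵘ-injective (begin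
    toℚᵘ (fromℤ (a ℤ.+ b))                ≈⟨ toℚᵘ-/ (a ℤ.+ b) 0 ⟩
    mkℚᵘ (a ℤ.+ b) 0                      ≈⟨ *≡* (cong (ℤ._* + 1) (sym (cong₂ ℤ._+_ (ℤP.*-identityʳ a) (ℤP.*-identityʳ b)))) ⟩
    mkℚᵘ a 0 ℚᵘ.+ mkℚᵘ b 0                ≈⟨ ℚᵘP.+-cong (toℚᵘ-/ a 0) (toℚᵘ-/ b 0) ⟨
    toℚᵘ (fromℤ a) ℚᵘ.+ toℚᵘ (fromℤ b)    ≈⟨ toℚᵘ-homo-+ (fromℤ a) (fromℤ b) ⟨
    toℚᵘ (fromℤ a + fromℤ b)              ∎)
    where open ℚᵘP.≃-Reasoning

  fromℤ-homo-* : ∀ a b → fromℤ (a ℤ.* b) ≡ fromℤ a * fromℤ b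
  fromℤ-homo-* a b = toℚᵘ-injective (begin
    toℚᵘ (fromℤ (a ℤ.* b))                ≈⟨ toℚᵘ-/ (a ℤ.* b) 0 ⟩
    mkℚᵘ (a ℤ.* b) 0                      ≈⟨ ℚᵘP.*-cong (toℚᵘ-/ a 0) (toℚᵘ-/ b 0) ⟨
    toℚᵘ (fromℤ a) ℚᵘ.* toℚᵘ (fromℤ b)    ≈⟨ toℚᵘ-homo-* (fromℤ a) (fromℤ b) ⟨
    toℚᵘ (fromℤ a * fromℤ b)              ∎)
    where open ℚᵘP.≃-Reasoning

  /≡fromℤ*recip : ∀ z n .{{_ : NonZero n}} → z / n ≡ fromℤ z * recip n
  /≡fromℤ*recip z (suc d) = toℚᵘ-injective (begin
    toℚᵘ (z / suc d)                           ≈⟨ toℚᵘ-/ z d ⟩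
    mkℚᵘ z d                                   ≈⟨ *≡* (trans (cong (λ x → z ℤ.* + suc x) (ℕP.+-identityʳ d)) (cong (ℤ._* + suc d) (sym (ℤP.*-identityʳ z)))) ⟩
    mkℚᵘ z 0 ℚᵘ.* mkℚᵘ (+ 1) d                 ≈⟨ ℚᵘP.*-cong (toℚᵘ-/ z 0) (toℚᵘ-/ (+ 1) d) ⟨
    toℚᵘ (fromℤ z) ℚᵘ.* toℚᵘ (recip (suc d))   ≈⟨ toℚᵘ-homo-* (fromℤ z) (recip (suc d)) ⟨
    toℚᵘ (fromℤ z * recip (suc d))             ∎)
    where open ℚᵘP.≃-Reasoning

  fromℤ*recip≡1 : ∀ n .{{_ : NonZero n}} → fromℤ (+ n) * recip n ≡ 1ℚ
  fromℤ*recip≡1 (suc d) = toℚᵘ-injective (begin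
    toℚᵘ (fromℤ (+ suc d) * recip (suc d))             ≈⟨ toℚᵘ-homo-* (fromℤ (+ suc d)) (recip (suc d)) ⟩
    toℚᵘ (fromℤ (+ suc d)) ℚᵘ.* toℚᵘ (recip (suc d))   ≈⟨ ℚᵘP.*-cong (toℚᵘ-/ (+ suc d) 0) (toℚᵘ-/ (+ 1) d) ⟩
    mkℚᵘ (+ suc d) 0 ℚᵘ.* mkℚᵘ (+ 1) d                 ≈⟨ *≡* (trans (ℤP.*-identityʳ _) (trans (ℤP.*-identityʳ _) (sym (trans (ℤP.*-identityˡ _) (cong (λ x → + suc x) (ℕP.+-identityʳ d)))))) ⟩
    mkℚᵘ (+ 1) 0                                       ∎)
    where open ℚᵘP.≃-Reasoning

  recip-homo-* : ∀ m n .{{_ : NonZero m}} .{{_ : NonZero n}} .{{_ : NonZero (m ℕ.* n)}} →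
                 recip (m ℕ.* n) ≡ recip m * recip n
  recip-homo-* (suc a) (suc b) = toℚᵘ-injective (begin
    toℚᵘ (recip (suc a ℕ.* suc b))                     ≈⟨ toℚᵘ-/ (+ 1) _ ⟩
    mkℚᵘ (+ 1) a ℚᵘ.* mkℚᵘ (+ 1) b                     ≈⟨ ℚᵘP.*-cong (toℚᵘ-/ (+ 1) a) (toℚᵘ-/ (+ 1) b) ⟨
    toℚᵘ (recip (suc a)) ℚᵘ.* toℚᵘ (recip (suc b))     ≈⟨ toℚᵘ-homo-* (recip (suc a)) (recip (suc b)) ⟨
    toℚᵘ (recip (suc a) * recip (suc b))               ∎)
    where open ℚᵘP.≃-Reasoning

  fromℤ-homo-neg : ∀ a → fromℤ (ℤ.- a) ≡ - fromℤ a
  fromℤ-homo-neg a = toℚᵘ-injective (begin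
    toℚᵘ (fromℤ (ℤ.- a))         ≈⟨ toℚᵘ-/ (ℤ.- a) 0 ⟩
    mkℚᵘ (ℤ.- a) 0               ≈⟨ ℚᵘP.-‿cong (toℚᵘ-/ a 0) ⟨
    ℚᵘ.- toℚᵘ (fromℤ a)          ≈⟨ toℚᵘ-homo‿- (fromℤ a) ⟨
    toℚᵘ (- fromℤ a)             ∎)
    where open ℚᵘP.≃-Reasoning

  fromℤ-homo-- : ∀ a b → fromℤ (a ℤ.- b) ≡ fromℤ a - fromℤ b
  fromℤ-homo-- a b = trans (fromℤ-homo-+ a (ℤ.- b)) (cong (λ x → fromℤ a + x) (fromℤ-homo-neg b))

  recip-cong : ∀ {m n} .{{_ : NonZero m}} .{{_ : NonZero n}} → m ≡ n → recip m ≡ recip n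
  recip-cong refl = refl

  fromℤ*recip-cancel : ∀ N {D m} .{{_ : NonZero D}} .{{_ : NonZero m}} → N ℕ.* m ≡ D → fromℤ (+ N) * recip D ≡ recip m
  fromℤ*recip-cancel N {m = m} refl = begin
    fromℤ (+ N) * recip (N ℕ.* m)          ≡⟨ cong (fromℤ (+ N) *_) (recip-homo-* N m) ⟩
    fromℤ (+ N) * (recip N * recip m)      ≡⟨ ℚP.*-assoc (fromℤ (+ N)) (recip N) (recip m) ⟨
    fromℤ (+ N) * recip N * recip m        ≡⟨ cong (_* recip m) (fromℤ*recip≡1 N) ⟩
    1ℚ * recip m                           ≡⟨ ℚP.*-identityˡ (recip m) ⟩
    recip m                                ∎
    where
    open ≡-Reasoning
    instance
      N≢0 : NonZero N
      N≢0 = ℕP.m*n≢0⇒m≢0 N {m}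

  fromℤ-sumℤ : ∀ n f → fromℤ (sumℤ n f) ≡ sumℚ n (fromℤ ∘ f)
  fromℤ-sumℤ zero    f = refl
  fromℤ-sumℤ (suc n) f = trans (fromℤ-homo-+ (sumℤ n f) (f n)) (cong (_+ fromℤ (f n)) (fromℤ-sumℤ n f))

module Formula where

  open import Algebra.Bundles using (CommutativeRing)
  open import Data.Integer.Base as ℤ using (ℤ; +_; -1ℤ)
  open import Data.Nat.Logarithm using (⌊log₂_⌋; ⌊log₂⌋-mono-≤; ⌊log₂[2^n]⌋≡n)
  open import Data.Rational.Base using (ℚ; _+_; _-_; -_; _*_; 1ℚ)
  import Data.Rational.Properties as ℚP
  open import Data.Rational.Solver using (module +-*-Solver)
  open +-*-Solver using (solve; _:+_; _:-_; :-_; _:*_; _:=_; con)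
  open BinaryExpansions
  open Signs using (-1^even; -1^odd; ∑-1^∑≡D-2∑; OddIndicesDownClosed)
  open Fractions

  module ℚ-Sums = FiniteSums.Properties (CommutativeRing.semiring ℚP.+-*-commutativeRing) sumℚ (λ _ → refl) (λ _ _ → refl)

  n<2^[1+⌊log₂n⌋] : ∀ n → n < 2 ℕ.^ (⌊log₂ n ⌋ ℕ.+ 1)
  n<2^[1+⌊log₂n⌋] n with n ℕP.<? 2 ℕ.^ (⌊log₂ n ⌋ ℕ.+ 1)
  ... | yes n<2^[1+l] = n<2^[1+l]
  ... | no  n≮2^[1+l] = ⊥-elim (ℕP.n≮n ⌊log₂ n ⌋ (begin-strict
    ⌊log₂ n ⌋                             <⟨ ℕP.n<1+n _ ⟩
    suc ⌊log₂ n ⌋                         ≡⟨ ℕP.+-comm 1 ⌊log₂ n ⌋ ⟩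
    ⌊log₂ n ⌋ ℕ.+ 1                       ≡⟨ ⌊log₂[2^n]⌋≡n (⌊log₂ n ⌋ ℕ.+ 1) ⟨
    ⌊log₂ (2 ℕ.^ (⌊log₂ n ⌋ ℕ.+ 1)) ⌋     ≤⟨ ⌊log₂⌋-mono-≤ (ℕP.≮⇒≥ n≮2^[1+l]) ⟩
    ⌊log₂ n ⌋                             ∎))
    where open ℕP.≤-Reasoning

  ⪯-Chain : ℕ → (ℕ → ℕ) → Set
  ⪯-Chain s k = ∀ {t u} → t ≤ u → u < s → k (suc t) ⪯ k (suc u)

  below-2^r : ∀ {s} k → ⪯-Chain s k → ∀ {t} → t < s → k (suc t) < 2 ℕ.^ (⌊log₂ (k s) ⌋ ℕ.+ 1)
  below-2^r k chain (s≤s t≤s′) = ℕP.≤-<-trans (⪯⇒≤ (chain t≤s′ ℕP.≤-refl)) (n<2^[1+⌊log₂n⌋] _)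

  weight : (ℕ → ℕ) → ℕ → ℚ
  weight k t = pow2frac 1 (w₂ (k (suc t)))

  ½^_ : ℕ → ℚ
  ½^ w = recip (2 ℕ.^ w) {{ℕP.m^n≢0 2 w}}

  pow2frac-1 : ∀ w → pow2frac 1 w ≡ fromℤ (+ 2) * ½^ w
  pow2frac-1 w = /≡fromℤ*recip (+ 2) (2 ℕ.^ w) {{ℕP.m^n≢0 2 w}}

  signedWeight : (ℕ → ℕ) → ℕ → ℚ
  signedWeight k t = fromℤ (-1ℤ ℤ.^ t) * weight k t

  c₀≡1-∑signedWeight : ∀ s k → ⪯-Chain s k → c₀ s k ≡ 1ℚ - sumℚ s (signedWeight k)
  c₀≡1-∑signedWeight s k chain = begin
    c₀ s k                                                       ≡⟨ /≡fromℤ*recip S D ⟩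
    fromℤ S * recip D                                            ≡⟨ cong (λ x → fromℤ x * recip D) (∑-1^∑≡D-2∑ D s (λ m i → m C k (suc i)) closed) ⟩
    fromℤ (+ D ℤ.- + 2 ℤ.* Z) * recip D                          ≡⟨ cong (_* recip D) (trans (fromℤ-homo-- (+ D) (+ 2 ℤ.* Z)) (cong (λ x → fromℤ (+ D) - x) (fromℤ-homo-* (+ 2) Z))) ⟩
    (fromℤ (+ D) - fromℤ (+ 2) * fromℤ Z) * recip D              ≡⟨ solve 4 (λ d t z r → (d :- t :* z) :* r := d :* r :- t :* (z :* r)) refl (fromℤ (+ D)) (fromℤ (+ 2)) (fromℤ Z) (recip D) ⟩
    fromℤ (+ D) * recip D - fromℤ (+ 2) * (fromℤ Z * recip D)    ≡⟨ cong₂ (λ x y → x - fromℤ (+ 2) * y) (fromℤ*recip≡1 D) Z/D≡∑u ⟩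
    1ℚ - fromℤ (+ 2) * sumℚ s u                                  ≡⟨ cong (λ x → 1ℚ - x) (ℚ-Sums.∑-*ˡ s (fromℤ (+ 2)) u) ⟨
    1ℚ - sumℚ s (λ t → fromℤ (+ 2) * u t)                        ≡⟨ cong (λ x → 1ℚ - x) (ℚ-Sums.∑-cong s (λ t _ → 2u≡signedWeight t)) ⟩
    1ℚ - sumℚ s (signedWeight k)                                 ∎
    where
    open ≡-Reasoning
    r : ℕ
    r = ⌊log₂ (k s) ⌋ ℕ.+ 1
    D : ℕ
    D = 2 ℕ.^ r
    instance
      D≢0 : NonZero D
      D≢0 = ℕP.m^n≢0 2 r
    S : ℤ
    S = sumℤ D (λ m → -1ℤ ℤ.^ sumℕ s (λ i → m C k (suc i)))
    Z : ℤ
    Z = sumℤ s (λ t → -1ℤ ℤ.^ t ℤ.* + oddBinomialCount r (k (suc t)))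
    u : ℕ → ℚ
    u t = fromℤ (-1ℤ ℤ.^ t) * ½^ w₂ (k (suc t))
    closed : ∀ m → OddIndicesDownClosed s (λ i → m C k (suc i))
    closed m t≤u u<s = Equivalence.from (lucas (binary _) m) ∘ ⪯-trans (chain t≤u u<s) ∘ Equivalence.to (lucas (binary _) m)
    term≡u : ∀ t → t < s → fromℤ (-1ℤ ℤ.^ t ℤ.* + oddBinomialCount r (k (suc t))) * recip D ≡ u t
    term≡u t t<s = begin
      fromℤ (-1ℤ ℤ.^ t ℤ.* + N) * recip D       ≡⟨ cong (_* recip D) (fromℤ-homo-* (-1ℤ ℤ.^ t) (+ N)) ⟩
      fromℤ (-1ℤ ℤ.^ t) * fromℤ (+ N) * recip D ≡⟨ ℚP.*-assoc (fromℤ (-1ℤ ℤ.^ t)) (fromℤ (+ N)) (recip D) ⟩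
      fromℤ (-1ℤ ℤ.^ t) * (fromℤ (+ N) * recip D) ≡⟨ cong (fromℤ (-1ℤ ℤ.^ t) *_) (fromℤ*recip-cancel N {{D≢0}} {{ℕP.m^n≢0 2 (w₂ (k (suc t)))}} (oddBinomialCount*2^w₂≡2^r r (below-2^r k chain t<s))) ⟩
      u t                                        ∎
      where
      N : ℕ
      N = oddBinomialCount r (k (suc t))
    Z/D≡∑u : fromℤ Z * recip D ≡ sumℚ s u
    Z/D≡∑u = begin
      fromℤ Z * recip D                                                  ≡⟨ cong (_* recip D) (fromℤ-sumℤ s _) ⟩
      sumℚ s (λ t → fromℤ (-1ℤ ℤ.^ t ℤ.* + oddBinomialCount r (k (suc t)))) * recip D   ≡⟨ ℚ-Sums.∑-*ʳ s (recip D) _ ⟨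
      sumℚ s (λ t → fromℤ (-1ℤ ℤ.^ t ℤ.* + oddBinomialCount r (k (suc t))) * recip D)   ≡⟨ ℚ-Sums.∑-cong s term≡u ⟩
      sumℚ s u                                                           ∎
    2u≡signedWeight : ∀ t → fromℤ (+ 2) * u t ≡ signedWeight k t
    2u≡signedWeight t = begin
      fromℤ (+ 2) * (fromℤ (-1ℤ ℤ.^ t) * ½^ w₂ (k (suc t)))   ≡⟨ solve 3 (λ a b c → a :* (b :* c) := b :* (a :* c)) refl (fromℤ (+ 2)) (fromℤ (-1ℤ ℤ.^ t)) (½^ w₂ (k (suc t))) ⟩
      fromℤ (-1ℤ ℤ.^ t) * (fromℤ (+ 2) * ½^ w₂ (k (suc t)))   ≡⟨ cong (fromℤ (-1ℤ ℤ.^ t) *_) (pow2frac-1 (w₂ (k (suc t)))) ⟨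
      fromℤ (-1ℤ ℤ.^ t) * weight k t                                     ∎

  ½^-+ : ∀ a b → ½^ (a ℕ.+ b) ≡ ½^ a * ½^ b
  ½^-+ a b = trans (recip-cong {{ℕP.m^n≢0 2 (a ℕ.+ b)}} {{2^a*2^b≢0}} (ℕP.^-distribˡ-+-* 2 a b))
                   (recip-homo-* (2 ℕ.^ a) (2 ℕ.^ b) {{ℕP.m^n≢0 2 a}} {{ℕP.m^n≢0 2 b}} {{2^a*2^b≢0}})
    where
    2^a*2^b≢0 : NonZero (2 ℕ.^ a ℕ.* 2 ℕ.^ b)
    2^a*2^b≢0 = ℕP.m*n≢0 (2 ℕ.^ a) (2 ℕ.^ b) {{ℕP.m^n≢0 2 a}} {{ℕP.m^n≢0 2 b}}

  2^w*½^w≡1 : ∀ w → fromℤ (+ 2 ℕ.^ w) * ½^ w ≡ 1ℚ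
  2^w*½^w≡1 w = fromℤ*recip≡1 (2 ℕ.^ w) {{ℕP.m^n≢0 2 w}}

  pow2frac-⪯ : ∀ {a b} → a ⪯ b → pow2frac 1 (w₂ a) ≡ fromℤ (+ 2 ℕ.^ w₂ (b ℕ.∸ a)) * pow2frac 1 (w₂ b)
  pow2frac-⪯ {a} {b} a⪯b = sym (begin
    P * pow2frac 1 (w₂ b)                    ≡⟨ cong (P *_) (pow2frac-1 (w₂ b)) ⟩
    P * (fromℤ (+ 2) * ½^ w₂ b)              ≡⟨ cong (λ w → P * (fromℤ (+ 2) * ½^ w)) (sym (w₂-⪯-∸ (binary b) a a⪯b)) ⟩
    P * (fromℤ (+ 2) * ½^ (w₂ a ℕ.+ δ))      ≡⟨ cong (λ x → P * (fromℤ (+ 2) * x)) (½^-+ (w₂ a) δ) ⟩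
    P * (fromℤ (+ 2) * (½^ w₂ a * ½^ δ))     ≡⟨ solve 4 (λ p t x y → p :* (t :* (x :* y)) := t :* x :* (p :* y)) refl P (fromℤ (+ 2)) (½^ w₂ a) (½^ δ) ⟩
    fromℤ (+ 2) * ½^ w₂ a * (P * ½^ δ)       ≡⟨ cong (fromℤ (+ 2) * ½^ w₂ a *_) (2^w*½^w≡1 δ) ⟩
    fromℤ (+ 2) * ½^ w₂ a * 1ℚ               ≡⟨ ℚP.*-identityʳ _ ⟩
    fromℤ (+ 2) * ½^ w₂ a                    ≡⟨ pow2frac-1 (w₂ a) ⟨
    pow2frac 1 (w₂ a)                        ∎)
    where
    open ≡-Reasoning
    δ : ℕ
    δ = w₂ (b ℕ.∸ a)
    P : ℚ
    P = fromℤ (+ 2 ℕ.^ δ)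

  -- The summand of rhs, written exactly as in its definition so that rhs unfolds to it.
  rhsPair : (ℕ → ℕ) → ℕ → ℚ
  rhsPair k j′ = (fromℤ (+ 2 ℕ.^ w₂ (k (2 ℕ.* suc j′) ℕ.∸ k (2 ℕ.* suc j′ ℕ.∸ 1))) - 1ℚ) * pow2frac 1 (w₂ (k (2 ℕ.* suc j′)))

  weight-pair : ∀ k j → k (suc (double j)) ⪯ k (suc (suc (double j))) →
                weight k (double j) - weight k (suc (double j)) ≡ rhsPair k j
  weight-pair k j a⪯b = begin
    pow2frac 1 (w₂ a) - X                  ≡⟨ cong (_- X) (pow2frac-⪯ a⪯b) ⟩
    P * X - X                              ≡⟨ solve 2 (λ p x → p :* x :- x := (p :- con 1ℚ) :* x) refl P X ⟩
    (P - 1ℚ) * X                           ≡⟨ cong (λ n → (fromℤ (+ 2 ℕ.^ w₂ (k n ℕ.∸ k (n ℕ.∸ 1))) - 1ℚ) * pow2frac 1 (w₂ (k n))) (sym (2*≡double (suc j))) ⟩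
    rhsPair k j                            ∎
    where
    open ≡-Reasoning
    a b : ℕ
    a = k (suc (double j))
    b = k (suc (suc (double j)))
    P X : ℚ
    P = fromℤ (+ 2 ℕ.^ w₂ (b ℕ.∸ a))
    X = pow2frac 1 (w₂ b)

  signedWeight-double : ∀ k j → signedWeight k (double j) ≡ weight k (double j)
  signedWeight-double k j = trans (cong (λ z → fromℤ z * weight k (double j)) (-1^even (double j) (parity-double j))) (ℚP.*-identityˡ _)

  signedWeight-1+double : ∀ k j → signedWeight k (suc (double j)) ≡ - weight k (suc (double j))
  signedWeight-1+double k j = trans (cong (λ z → fromℤ z * weight k (suc (double j))) (-1^odd (suc (double j)) (parity-1+double j))) (solve 1 (λ x → con (fromℤ -1ℤ) :* x := :- x) refl (weight k (suc (double j))))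

  ∑signedWeight≡∑rhsPair : ∀ {s} n k → ⪯-Chain s k → double n ≤ s → sumℚ (double n) (signedWeight k) ≡ sumℚ n (rhsPair k)
  ∑signedWeight≡∑rhsPair n k chain 2n≤s = begin
    sumℚ (double n) (signedWeight k)                                                     ≡⟨ ℚ-Sums.∑-double n (signedWeight k) ⟩
    sumℚ n (λ j → signedWeight k (double j) + signedWeight k (suc (double j)))           ≡⟨ ℚ-Sums.∑-cong n (λ j _ → cong₂ _+_ (signedWeight-double k j) (signedWeight-1+double k j)) ⟩
    sumℚ n (λ j → weight k (double j) - weight k (suc (double j)))                       ≡⟨ ℚ-Sums.∑-cong n (λ j j<n → weight-pair k j (chain (ℕP.n≤1+n _) (1+2j<s j<n))) ⟩
    sumℚ n (rhsPair k)                                                                   ∎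
    where
    open ≡-Reasoning
    1+2j<s : ∀ {j} → j < n → suc (double j) < _
    1+2j<s {j} j<n = ℕP.<-≤-trans (double-mono-< j<n) 2n≤s

  rhs-double : ∀ n k → rhs (double n) k ≡ 1ℚ - sumℚ n (rhsPair k)
  rhs-double n k = begin
    1ℚ - fromℤ (+ (double n ℕ.% 2)) * X - sumℚ (double n ℕ./ 2) (rhsPair k)   ≡⟨ cong₂ (λ r h → 1ℚ - fromℤ (+ r) * X - sumℚ h (rhsPair k)) (double-%2 n) (double-/2 n) ⟩
    1ℚ - fromℤ (+ 0) * X - Σ                                                ≡⟨ solve 2 (λ x y → con 1ℚ :- con (fromℤ (+ 0)) :* x :- y := con 1ℚ :- y) refl X Σ ⟩
    1ℚ - Σ                                                                  ∎
    where
    open ≡-Reasoning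
    X Σ : ℚ
    X = pow2frac 1 (w₂ (k (double n)))
    Σ = sumℚ n (rhsPair k)

  rhs-1+double : ∀ n k → rhs (suc (double n)) k ≡ 1ℚ - (sumℚ n (rhsPair k) + weight k (double n))
  rhs-1+double n k = begin
    1ℚ - fromℤ (+ (suc (double n) ℕ.% 2)) * X - sumℚ (suc (double n) ℕ./ 2) (rhsPair k)   ≡⟨ cong₂ (λ r h → 1ℚ - fromℤ (+ r) * X - sumℚ h (rhsPair k)) (1+double-%2 n) (1+double-/2 n) ⟩
    1ℚ - fromℤ (+ 1) * X - Σ                                                            ≡⟨ solve 2 (λ x y → con 1ℚ :- con (fromℤ (+ 1)) :* x :- y := con 1ℚ :- (y :+ x)) refl X Σ ⟩
    1ℚ - (Σ + X)                                                                        ∎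
    where
    open ≡-Reasoning
    X Σ : ℚ
    X = pow2frac 1 (w₂ (k (suc (double n))))
    Σ = sumℚ n (rhsPair k)

  consecutive⇒⪯-Chain : ∀ {s k} → (∀ i → 1 ≤ i → i < s → k i ⪯ k (suc i)) → ⪯-Chain s k
  consecutive⇒⪯-Chain {k = k} H = consecutive⇒chain _⪯_ ⪯-refl ⪯-trans (k ∘ suc) (λ i 1+i<s → H (suc i) (s≤s z≤n) 1+i<s)

  c₀≡rhs : ∀ {s} k → EvenOrOdd s → ⪯-Chain s k → c₀ s k ≡ rhs s k
  c₀≡rhs k (even n) chain = begin
    c₀ (double n) k                          ≡⟨ c₀≡1-∑signedWeight (double n) k chain ⟩
    1ℚ - sumℚ (double n) (signedWeight k)    ≡⟨ cong (λ x → 1ℚ - x) (∑signedWeight≡∑rhsPair n k chain ℕP.≤-refl) ⟩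
    1ℚ - sumℚ n (rhsPair k)                  ≡⟨ rhs-double n k ⟨
    rhs (double n) k                         ∎
    where open ≡-Reasoning
  c₀≡rhs k (odd n) chain = begin
    c₀ (suc (double n)) k                                                 ≡⟨ c₀≡1-∑signedWeight (suc (double n)) k chain ⟩
    1ℚ - (sumℚ (double n) (signedWeight k) + signedWeight k (double n))  ≡⟨ cong₂ (λ x y → 1ℚ - (x + y)) (∑signedWeight≡∑rhsPair n k chain (ℕP.n≤1+n _)) (signedWeight-double k n) ⟩
    1ℚ - (sumℚ n (rhsPair k) + weight k (double n))                       ≡⟨ rhs-1+double n k ⟨
    rhs (suc (double n)) k                                                ∎
    where open ≡-Reasoning

open BinaryExpansions using (evenOrOdd)
open Formula using (c₀≡rhs; consecutive⇒⪯-Chain)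

mainTheorem10 : (s : ℕ) → 1 ≤ s → (k : ℕ → ℕ)
    → (∀ i → 1 ≤ i → i ≤ s → 1 ≤ k i)
    → (∀ i → 1 ≤ i → i < s → k i ⪯ k (suc i))
    → c₀ s k ≡ rhs s k
mainTheorem10 s _ k _ H = c₀≡rhs k (evenOrOdd s) (consecutive⇒⪯-Chain H)
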